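{- Let $C,D$ be $\mathcal{EL}$ concepts. If $C\sqsubset^{\mathit{syn}}D$, then $C\sqsubset^\emptyset D$. Moreover, the length of any $\sqsubset^{\mathit{syn}}$-chain $C=E_0\sqsubset^{\mathit{syn}}E_1\sqsubset^{\mathit{syn}}\cdots\sqsubset^{\mathit{syn}}E_n$ issuing from $C$ is bounded by a linear function of the size of $C$.
   Context: $\mathcal{EL}$ concepts: $C::=A\mid\top\mid C\sqcap C\mid\exists r.C$ ($A$ concept name, $r$ role name), interpreted by $\top^\mathcal{I}=\Delta^\mathcal{I}$, $(C\sqcap D)^\mathcal{I}=C^\mathcal{I}\cap D^\mathcal{I}$, $(\exists r.C)^\mathcal{I}=\{d\mid\exists e\in C^\mathcal{I},(d,e)\in r^\mathcal{I}\}$; size = number of occurrences of $\top$, concept names and role names. $C\sqsubseteq^\emptyset D$ iff $C^\mathcal{I}\subseteq D^\mathcal{I}$ for all $\mathcal{I}$; $C\equiv^\emptyset D$ iff both directions; $C\sqsubset^\emptyset D$ iff $C\sqsubseteq^\emptyset D$ and $C\not\equiv^\emptyset D$. The reduced form of $C$ is obtained by exhaustively replacing subconcepts $E\sqcap F$ with $E\sqsubseteq^\emptyset F$ by $E$ (modulo associativity and commutativity of $\sqcap$). $D$ is a syntactic generalization of $C$, written $C\sqsubset^{\mathit{syn}}D$, if $D$ is obtained from the reduced form of $C$ by replacing some (at least one) occurrences of subconcepts different from $\top$ by $\top$. -}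

module Defs where

open import Data.Nat using (ℕ; zero; suc; _+_)
open import Data.Product using (_×_; Σ; ∃)
open import Data.Sum using (_⊎_)
open import Relation.Nullary using (¬_)
open import Relation.Binary.PropositionalEquality using (_≡_; _≢_)
open import Relation.Binary.Construct.Closure.ReflexiveTransitive using (Star)

ConceptName : Set
ConceptName = ℕ

RoleName : Set
RoleName = ℕ

infixr 7 _⊓_
data Concept : Set where
  atom : ConceptName → Concept
  ⊤    : Concept
  _⊓_  : Concept → Concept → Concept
  ex   : RoleName → Concept → Concept

size : Concept → ℕ
size (atom A) = 1
size ⊤        = 1
size (C ⊓ D)  = size C + size D
size (ex r C) = suc (size C)

record Interpretation : Set₁ where
  field
    Δ    : Set
    conc : ConceptName → Δ → Set
    role : RoleName → Δ → Δ → Set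

open Interpretation

⟦_⟧ : Concept → (I : Interpretation) → Δ I → Set
⟦ atom A ⟧ I d = conc I A d
⟦ ⊤ ⟧      I d = Data.Unit.⊤ where import Data.Unit
⟦ C ⊓ D ⟧  I d = ⟦ C ⟧ I d × ⟦ D ⟧ I d
⟦ ex r C ⟧ I d = Σ (Δ I) λ e → role I r d e × ⟦ C ⟧ I e

_⊑_ : Concept → Concept → Set₁
C ⊑ D = (I : Interpretation) (d : Δ I) → ⟦ C ⟧ I d → ⟦ D ⟧ I d

_≡∅_ : Concept → Concept → Set₁
C ≡∅ D = (C ⊑ D) × (D ⊑ C)

_⊏_ : Concept → Concept → Set₁
C ⊏ D = (C ⊑ D) × ¬ (C ≡∅ D)

data _≈AC_ : Concept → Concept → Set where
  ac-refl  : ∀ {C} → C ≈AC C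
  ac-sym   : ∀ {C D} → C ≈AC D → D ≈AC C
  ac-trans : ∀ {C D E} → C ≈AC D → D ≈AC E → C ≈AC E
  ac-comm  : ∀ {C D} → (C ⊓ D) ≈AC (D ⊓ C)
  ac-assoc : ∀ {C D E} → ((C ⊓ D) ⊓ E) ≈AC (C ⊓ (D ⊓ E))
  ac-⊓     : ∀ {C C' D D'} → C ≈AC C' → D ≈AC D' → (C ⊓ D) ≈AC (C' ⊓ D')
  ac-ex    : ∀ {r C C'} → C ≈AC C' → ex r C ≈AC ex r C'

data Step : Concept → Concept → Set₁ where
  red  : ∀ {E F} → E ⊑ F → Step (E ⊓ F) E
  inL  : ∀ {C C' D} → Step C C' → Step (C ⊓ D) (C' ⊓ D)
  inR  : ∀ {C D D'} → Step D D' → Step (C ⊓ D) (C ⊓ D')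
  inEx : ∀ {r C C'} → Step C C' → Step (ex r C) (ex r C')

data ReduceAC : Concept → Concept → Set₁ where
  byAC   : ∀ {C D} → C ≈AC D → ReduceAC C D
  byStep : ∀ {C D} → Step C D → ReduceAC C D

Irreducible : Concept → Set₁
Irreducible C = ∀ {C' C''} → C ≈AC C' → ¬ Step C' C''

ReducedForm : Concept → Concept → Set₁
ReducedForm C R = Star ReduceAC C R × Irreducible R

data Repl : Concept → Concept → Set where
  keep  : ∀ {C} → Repl C C
  top   : ∀ {C} → C ≢ ⊤ → Repl C ⊤
  repl⊓ : ∀ {C C' D D'} → Repl C C' → Repl D D' → Repl (C ⊓ D) (C' ⊓ D')
  replEx : ∀ {r C C'} → Repl C C' → Repl (ex r C) (ex r C')

data Repl⁺ : Concept → Concept → Set where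
  top   : ∀ {C} → C ≢ ⊤ → Repl⁺ C ⊤
  replL : ∀ {C C' D D'} → Repl⁺ C C' → Repl D D' → Repl⁺ (C ⊓ D) (C' ⊓ D')
  replR : ∀ {C C' D D'} → Repl C C' → Repl⁺ D D' → Repl⁺ (C ⊓ D) (C' ⊓ D')
  replEx : ∀ {r C C'} → Repl⁺ C C' → Repl⁺ (ex r C) (ex r C')

_⊏syn_ : Concept → Concept → Set₁
C ⊏syn D = Σ Concept λ R → ReducedForm C R × Repl⁺ R D

data SynChain : Concept → ℕ → Set₁ where
  done : ∀ {C} → SynChain C zero
  step : ∀ {C D n} → C ⊏syn D → SynChain D n → SynChain C (suc n)

module Submission where

-- Strictness: evaluate everything in the canonical model, whose elements are concepts, where Y
-- satisfies A (resp. has an r-successor Y') iff A (resp. ∃r.Y') is a top-level conjunct of Y.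
-- Every concept D satisfies itself there, so D ⊑ C would make D satisfy the reduced form R of C.
-- But each conjunct of R must then be witnessed by a top-level conjunct of D, which is either the
-- corresponding conjunct of R itself or a generalization of a different conjunct of R; the latter
-- would make one conjunct of R subsume another, contradicting irreducibility.
-- Chain bound: with the weight counting atoms and role names twice and ⊤ once, reduction does not
-- increase the weight while replacing a non-⊤ subconcept by ⊤ strictly decreases it, and the
-- weight is at most twice the size.

open import Defs
open import Data.Nat using (ℕ; suc; _+_; _*_; _≤_; _<_; z≤n; s≤s)
open import Data.Nat.Properties
open import Data.Product using (_×_; Σ; _,_; proj₁; proj₂)
open import Data.Sum using (_⊎_; inj₁; inj₂; swap)
open import Data.Unit using (tt)
open import Data.Empty using (⊥-elim)
open import Function using (_∘_)
open import Relation.Nullary using (¬_)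
open import Relation.Binary.PropositionalEquality using (_≡_; _≢_; refl; sym; trans; cong; cong₂)
open import Relation.Binary.Construct.Closure.ReflexiveTransitive using (Star; ε; _◅_)
open Interpretation

≈AC-sound : ∀ {C D} → C ≈AC D → (C ⊑ D) × (D ⊑ C)
≈AC-sound ac-refl        = (λ I d x → x) , (λ I d x → x)
≈AC-sound (ac-sym p)     = proj₂ (≈AC-sound p) , proj₁ (≈AC-sound p)
≈AC-sound (ac-trans p q) = (λ I d x → q₁ I d (p₁ I d x)) , (λ I d x → p₂ I d (q₂ I d x))
  where
  p₁ = proj₁ (≈AC-sound p); p₂ = proj₂ (≈AC-sound p)
  q₁ = proj₁ (≈AC-sound q); q₂ = proj₂ (≈AC-sound q)
≈AC-sound ac-comm        = (λ I d (x , y) → y , x) , (λ I d (y , x) → x , y)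
≈AC-sound ac-assoc       = (λ I d ((x , y) , z) → x , (y , z)) , (λ I d (x , (y , z)) → (x , y) , z)
≈AC-sound (ac-⊓ p q)     =
  (λ I d (x , y) → proj₁ (≈AC-sound p) I d x , proj₁ (≈AC-sound q) I d y) ,
  (λ I d (x , y) → proj₂ (≈AC-sound p) I d x , proj₂ (≈AC-sound q) I d y)
≈AC-sound (ac-ex p)      =
  (λ I d (e , rde , x) → e , rde , proj₁ (≈AC-sound p) I e x) ,
  (λ I d (e , rde , x) → e , rde , proj₂ (≈AC-sound p) I e x)

Step-sound : ∀ {C D} → Step C D → C ⊑ D
Step-sound (red _)  I d (x , _)       = x
Step-sound (inL s)  I d (x , y)       = Step-sound s I d x , y
Step-sound (inR s)  I d (x , y)       = x , Step-sound s I d y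
Step-sound (inEx s) I d (e , rde , x) = e , rde , Step-sound s I e x

-- Only this direction is needed.
reduction-sound : ∀ {C D} → Star ReduceAC C D → C ⊑ D
reduction-sound ε               I d x = x
reduction-sound (byAC p ◅ rs)   I d x = reduction-sound rs I d (proj₁ (≈AC-sound p) I d x)
reduction-sound (byStep s ◅ rs) I d x = reduction-sound rs I d (Step-sound s I d x)

Repl-sound : ∀ {C D} → Repl C D → C ⊑ D
Repl-sound keep        I d x             = x
Repl-sound (top _)     I d _             = tt
Repl-sound (repl⊓ p q) I d (x , y)       = Repl-sound p I d x , Repl-sound q I d y
Repl-sound (replEx p)  I d (e , rde , x) = e , rde , Repl-sound p I e x

Repl⁺⇒Repl : ∀ {C D} → Repl⁺ C D → Repl C D
Repl⁺⇒Repl (top ne)    = top ne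
Repl⁺⇒Repl (replL p q) = repl⊓ (Repl⁺⇒Repl p) q
Repl⁺⇒Repl (replR p q) = repl⊓ p (Repl⁺⇒Repl q)
Repl⁺⇒Repl (replEx p)  = replEx (Repl⁺⇒Repl p)

data Conjunct : Concept → Concept → Set where
  here  : ∀ {X} → Conjunct X X
  left  : ∀ {X Y Z} → Conjunct X Y → Conjunct X (Y ⊓ Z)
  right : ∀ {X Y Z} → Conjunct X Z → Conjunct X (Y ⊓ Z)

Conjunct-trans : ∀ {X Y Z} → Conjunct X Y → Conjunct Y Z → Conjunct X Z
Conjunct-trans p here      = p
Conjunct-trans p (left q)  = left (Conjunct-trans p q)
Conjunct-trans p (right q) = right (Conjunct-trans p q)

Conjunct-sound : ∀ {X Y} → Conjunct X Y → Y ⊑ X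
Conjunct-sound here      I d x       = x
Conjunct-sound (left p)  I d (x , _) = Conjunct-sound p I d x
Conjunct-sound (right p) I d (_ , y) = Conjunct-sound p I d y

data Atomic : Concept → Set where
  atom : ∀ {A} → Atomic (atom A)
  ex   : ∀ {r X} → Atomic (ex r X)

Atomic-Conjunct-⊓ : ∀ {Z C D} → Conjunct Z (C ⊓ D) → Atomic Z → Conjunct Z C ⊎ Conjunct Z D
Atomic-Conjunct-⊓ (left t)  _ = inj₁ t
Atomic-Conjunct-⊓ (right t) _ = inj₂ t

canonical : Interpretation
canonical = record
  { Δ    = Concept
  ; conc = λ A Y → Conjunct (atom A) Y
  ; role = λ r Y Y' → Conjunct (ex r Y') Y
  }

canonical-sound : ∀ X {Y} → ⟦ X ⟧ canonical Y → Y ⊑ X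
canonical-sound (atom A) t           = Conjunct-sound t
canonical-sound ⊤ _                  I d _ = tt
canonical-sound (X ⊓ X') (y , y')    I d x = canonical-sound X y I d x , canonical-sound X' y' I d x
canonical-sound (ex r X) (e , t , y) I d x =
  let e' , rde' , x' = Conjunct-sound t I d x in e' , rde' , canonical-sound X y I e' x'

Conjunct⇒canonical : ∀ X {Y} → Conjunct X Y → ⟦ X ⟧ canonical Y
Conjunct⇒canonical (atom A) t = t
Conjunct⇒canonical ⊤ _        = tt
Conjunct⇒canonical (X ⊓ X') t =
  Conjunct⇒canonical X (Conjunct-trans (left here) t) , Conjunct⇒canonical X' (Conjunct-trans (right here) t)
Conjunct⇒canonical (ex r X) t = X , t , Conjunct⇒canonical X here

Repl-Conjunct⁻¹ : ∀ {R D Z} → Repl R D → Conjunct Z D →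
                  Z ≡ ⊤ ⊎ Σ Concept (λ W → Conjunct W R × Repl W Z)
Repl-Conjunct⁻¹ keep t                = inj₂ (_ , t , keep)
Repl-Conjunct⁻¹ (top _) here          = inj₁ refl
Repl-Conjunct⁻¹ (repl⊓ p q) here      = inj₂ (_ , here , repl⊓ p q)
Repl-Conjunct⁻¹ (repl⊓ p q) (left t)  with Repl-Conjunct⁻¹ p t
... | inj₁ Z≡⊤            = inj₁ Z≡⊤
... | inj₂ (W , tW , rW)  = inj₂ (W , left tW , rW)
Repl-Conjunct⁻¹ (repl⊓ p q) (right t) with Repl-Conjunct⁻¹ q t
... | inj₁ Z≡⊤            = inj₁ Z≡⊤
... | inj₂ (W , tW , rW)  = inj₂ (W , right tW , rW)
Repl-Conjunct⁻¹ (replEx p) here       = inj₂ (_ , here , replEx p)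

Reducible : Concept → Set₁
Reducible C = Σ Concept λ C' → Σ Concept λ C'' → C ≈AC C' × Step C' C''

Irreducible⇒¬Reducible : ∀ {C} → Irreducible C → ¬ Reducible C
Irreducible⇒¬Reducible irr (_ , _ , eq , s) = irr eq s

Reducible-≈AC : ∀ {C C'} → C ≈AC C' → Reducible C' → Reducible C
Reducible-≈AC eq (_ , _ , eq' , s) = _ , _ , ac-trans eq eq' , s

Reducible-⊓ˡ : ∀ {C D} → Reducible C → Reducible (C ⊓ D)
Reducible-⊓ˡ (_ , _ , eq , s) = _ , _ , ac-⊓ eq ac-refl , inL s

Reducible-⊓ʳ : ∀ {C D} → Reducible D → Reducible (C ⊓ D)
Reducible-⊓ʳ (_ , _ , eq , s) = _ , _ , ac-⊓ ac-refl eq , inR s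

Reducible-ex : ∀ {r C} → Reducible C → Reducible (ex r C)
Reducible-ex (_ , _ , eq , s) = _ , _ , ac-ex eq , inEx s

Conjunct-subsumed⇒Reducible : ∀ {C D W W'} → Conjunct W C → Conjunct W' D → W' ⊑ W →
                              Reducible (C ⊓ D)
Conjunct-subsumed⇒Reducible here here s = _ , _ , ac-comm , red s
Conjunct-subsumed⇒Reducible here (left t') s =
  Reducible-≈AC (ac-sym ac-assoc) (Reducible-⊓ˡ (Conjunct-subsumed⇒Reducible here t' s))
Conjunct-subsumed⇒Reducible here (right t') s =
  Reducible-≈AC (ac-trans (ac-⊓ ac-refl ac-comm) (ac-sym ac-assoc))
    (Reducible-⊓ˡ (Conjunct-subsumed⇒Reducible here t' s))
Conjunct-subsumed⇒Reducible (left t) t' s =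
  Reducible-≈AC (ac-trans ac-assoc (ac-trans (ac-⊓ ac-refl ac-comm) (ac-sym ac-assoc)))
    (Reducible-⊓ˡ (Conjunct-subsumed⇒Reducible t t' s))
Conjunct-subsumed⇒Reducible (right t) t' s =
  Reducible-≈AC ac-assoc (Reducible-⊓ʳ (Conjunct-subsumed⇒Reducible t t' s))

-- The atomic conjuncts of Y are distributed over D₁ and a generalization D₂ of R₂; those coming
-- from D₂ cannot witness a conjunct of R₁, since no conjunct of R₂ is subsumed by one of R₁.
canonical-restrict : ∀ R₁ {R₂ D₁ D₂ Y} →
  (∀ {W W'} → Conjunct W R₁ → Conjunct W' R₂ → ¬ W' ⊑ W) → Repl R₂ D₂ →
  (∀ {Z} → Conjunct Z Y → Atomic Z → Conjunct Z D₁ ⊎ Conjunct Z D₂) →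
  ⟦ R₁ ⟧ canonical Y → ⟦ R₁ ⟧ canonical D₁
canonical-restrict (atom A) disjoint gen split y with split y atom
... | inj₁ t = t
... | inj₂ t with Repl-Conjunct⁻¹ gen t
...   | inj₁ ()
...   | inj₂ (W' , tW' , rW') = ⊥-elim (disjoint here tW' (Repl-sound rW'))
canonical-restrict ⊤ _ _ _ _ = tt
canonical-restrict (X ⊓ X') disjoint gen split (y , y') =
  canonical-restrict X (λ t → disjoint (Conjunct-trans t (left here))) gen split y ,
  canonical-restrict X' (λ t → disjoint (Conjunct-trans t (right here))) gen split y'
canonical-restrict (ex r X) disjoint gen split (e , t , y) with split t ex
... | inj₁ t₁ = e , t₁ , y
... | inj₂ t₂ with Repl-Conjunct⁻¹ gen t₂
...   | inj₁ ()
...   | inj₂ (W' , tW' , rW') =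
  ⊥-elim (disjoint here tW' λ I d w → canonical-sound (ex r X) (e , here , y) I d (Repl-sound rW' I d w))

Repl⁺-∉canonical : ∀ {R D} → ¬ Reducible R → Repl⁺ R D → ¬ ⟦ R ⟧ canonical D
Repl⁺-∉canonical {⊤} _ (top ⊤≢⊤) _ = ⊤≢⊤ refl
Repl⁺-∉canonical {_ ⊓ Y} ¬red (top _) (_ , y) =
  ¬red (_ , _ , ac-refl , red (λ I d _ → canonical-sound Y y I d tt))
Repl⁺-∉canonical {ex _ _} _ (top _) (_ , () , _)
Repl⁺-∉canonical {C ⊓ D} ¬red (replL p q) (c , _) =
  Repl⁺-∉canonical (¬red ∘ Reducible-⊓ˡ) p
    (canonical-restrict C (λ t t' s → ¬red (Conjunct-subsumed⇒Reducible t t' s))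
      q Atomic-Conjunct-⊓ c)
Repl⁺-∉canonical {C ⊓ D} ¬red (replR p q) (_ , d) =
  Repl⁺-∉canonical (¬red ∘ Reducible-⊓ʳ) q
    (canonical-restrict D (λ t t' s → ¬red (Reducible-≈AC ac-comm (Conjunct-subsumed⇒Reducible t t' s)))
      p (λ t a → swap (Atomic-Conjunct-⊓ t a)) d)
Repl⁺-∉canonical ¬red (replEx p) (_ , here , x) =
  Repl⁺-∉canonical (¬red ∘ Reducible-ex) p x

⊏syn⇒⊏ : ∀ {C D} → C ⊏syn D → C ⊏ D
⊏syn⇒⊏ {C} {D} (R , (reduction , irr) , gen) = C⊑D , λ (_ , D⊑C) →
  Repl⁺-∉canonical (Irreducible⇒¬Reducible irr) gen
    (C⊑R canonical D (D⊑C canonical D (Conjunct⇒canonical D here)))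
  where
  C⊑R : C ⊑ R
  C⊑R = reduction-sound reduction
  C⊑D : C ⊑ D
  C⊑D I d x = Repl-sound (Repl⁺⇒Repl gen) I d (C⊑R I d x)

weight : Concept → ℕ
weight (atom A) = 2
weight ⊤        = 1
weight (C ⊓ D)  = weight C + weight D
weight (ex r C) = 2 + weight C

weight-positive : ∀ C → 1 ≤ weight C
weight-positive (atom A) = s≤s z≤n
weight-positive ⊤        = s≤s z≤n
weight-positive (C ⊓ D)  = ≤-trans (weight-positive C) (m≤m+n (weight C) (weight D))
weight-positive (ex r C) = s≤s z≤n

weight-≢⊤ : ∀ C → C ≢ ⊤ → 2 ≤ weight C
weight-≢⊤ (atom A) _   = s≤s (s≤s z≤n)
weight-≢⊤ ⊤ ⊤≢⊤        = ⊥-elim (⊤≢⊤ refl)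
weight-≢⊤ (C ⊓ D) _    = +-mono-≤ (weight-positive C) (weight-positive D)
weight-≢⊤ (ex r C) _   = s≤s (s≤s z≤n)

weight≤2*size : ∀ C → weight C ≤ 2 * size C
weight≤2*size (atom A) = ≤-refl
weight≤2*size ⊤        = s≤s z≤n
weight≤2*size (C ⊓ D)  = begin
  weight C + weight D      ≤⟨ +-mono-≤ (weight≤2*size C) (weight≤2*size D) ⟩
  2 * size C + 2 * size D  ≡⟨ *-distribˡ-+ 2 (size C) (size D) ⟨
  2 * (size C + size D)    ∎
  where open ≤-Reasoning
weight≤2*size (ex r C) = begin
  2 + weight C             ≤⟨ +-monoʳ-≤ 2 (weight≤2*size C) ⟩
  2 + 2 * size C           ≡⟨ *-suc 2 (size C) ⟨
  2 * suc (size C)         ∎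
  where open ≤-Reasoning

weight-≈AC : ∀ {C D} → C ≈AC D → weight C ≡ weight D
weight-≈AC ac-refl                = refl
weight-≈AC (ac-sym p)             = sym (weight-≈AC p)
weight-≈AC (ac-trans p q)         = trans (weight-≈AC p) (weight-≈AC q)
weight-≈AC {C ⊓ D} ac-comm        = +-comm (weight C) (weight D)
weight-≈AC {(C ⊓ D) ⊓ E} ac-assoc = +-assoc (weight C) (weight D) (weight E)
weight-≈AC (ac-⊓ p q)             = cong₂ _+_ (weight-≈AC p) (weight-≈AC q)
weight-≈AC (ac-ex p)              = cong (2 +_) (weight-≈AC p)

weight-Step : ∀ {C D} → Step C D → weight D ≤ weight C
weight-Step (red {E} {F} _)   = m≤m+n (weight E) (weight F)
weight-Step (inL {D = D} s)   = +-monoˡ-≤ (weight D) (weight-Step s)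
weight-Step (inR {C = C} s)   = +-monoʳ-≤ (weight C) (weight-Step s)
weight-Step (inEx s)          = +-monoʳ-≤ 2 (weight-Step s)

weight-reduction : ∀ {C D} → Star ReduceAC C D → weight D ≤ weight C
weight-reduction ε               = ≤-refl
weight-reduction (byAC p ◅ rs)   = ≤-trans (weight-reduction rs) (≤-reflexive (sym (weight-≈AC p)))
weight-reduction (byStep s ◅ rs) = ≤-trans (weight-reduction rs) (weight-Step s)

weight-Repl : ∀ {C D} → Repl C D → weight D ≤ weight C
weight-Repl keep            = ≤-refl
weight-Repl {C} (top _)     = weight-positive C
weight-Repl (repl⊓ p q)     = +-mono-≤ (weight-Repl p) (weight-Repl q)
weight-Repl (replEx p)      = +-monoʳ-≤ 2 (weight-Repl p)

weight-Repl⁺ : ∀ {C D} → Repl⁺ C D → weight D < weight C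
weight-Repl⁺ {C} (top C≢⊤)  = weight-≢⊤ C C≢⊤
weight-Repl⁺ (replL p q)    = +-mono-<-≤ (weight-Repl⁺ p) (weight-Repl q)
weight-Repl⁺ (replR p q)    = +-mono-≤-< (weight-Repl p) (weight-Repl⁺ q)
weight-Repl⁺ (replEx p)     = +-monoʳ-< 2 (weight-Repl⁺ p)

weight-⊏syn : ∀ {C D} → C ⊏syn D → weight D < weight C
weight-⊏syn (R , (reduction , _) , gen) = <-≤-trans (weight-Repl⁺ gen) (weight-reduction reduction)

SynChain-length≤weight : ∀ {C n} → SynChain C n → n ≤ weight C
SynChain-length≤weight done           = z≤n
SynChain-length≤weight (step C⊏D ch)  = ≤-trans (s≤s (SynChain-length≤weight ch)) (weight-⊏syn C⊏D)

lemma31 : ((C D : Concept) → C ⊏syn D → C ⊏ D)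
    × Σ ℕ (λ a → Σ ℕ (λ b → (C : Concept) (n : ℕ) → SynChain C n → n ≤ a * size C + b))
lemma31 = (λ C D → ⊏syn⇒⊏) , 2 , 0 , chain-bound
  where
  chain-bound : (C : Concept) (n : ℕ) → SynChain C n → n ≤ 2 * size C + 0
  chain-bound C n ch = ≤-trans (SynChain-length≤weight ch) (≤-trans (weight≤2*size C) (m≤m+n _ 0))
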